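{- For every integer $n \geq 1$ and every integer $m$ with $0 \leq m \leq \binom{n}{2}$ there exists a graph on $n$ vertices with exactly $m$ edges that contains no induced paw.
   Context: All graphs are finite and simple. The paw is the graph consisting of a triangle $K_3$ together with one additional vertex joined by an edge to exactly one vertex of the triangle. -}

module Defs where

open import Data.Nat using (ℕ; _<_; _<ᵇ_)
open import Data.Bool using (Bool; true; false; _∧_)
open import Data.Fin using (Fin; toℕ)
open import Data.List using (List; length; filter; cartesianProduct; allFin)
open import Data.Product using (_×_; _,_; proj₁; proj₂)
open import Relation.Binary.PropositionalEquality using (_≡_; _≢_)
open import Relation.Nullary using (¬_)
open import Data.Bool using (T)
open import Data.Bool.Properties using (T?)

record SimpleGraph (n : ℕ) : Set where
  field
    adj   : Fin n → Fin n → Bool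
    sym   : ∀ i j → adj i j ≡ adj j i
    irrefl : ∀ i → adj i i ≡ false
open SimpleGraph public

edgeCount : ∀ {n} → SimpleGraph n → ℕ
edgeCount {n} G =
  length (filter (λ p → T? ((toℕ (proj₁ p) <ᵇ toℕ (proj₂ p)) ∧ adj G (proj₁ p) (proj₂ p)))
                 (cartesianProduct (allFin n) (allFin n)))

-- The paw on vertex set Fin 4: triangle 0,1,2 and pendant vertex 3 adjacent to 0.
pawAdj : Fin 4 → Fin 4 → Bool
pawAdj Fin.zero (Fin.suc Fin.zero) = true
pawAdj Fin.zero (Fin.suc (Fin.suc Fin.zero)) = true
pawAdj Fin.zero (Fin.suc (Fin.suc (Fin.suc Fin.zero))) = true
pawAdj (Fin.suc Fin.zero) Fin.zero = true
pawAdj (Fin.suc Fin.zero) (Fin.suc (Fin.suc Fin.zero)) = true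
pawAdj (Fin.suc (Fin.suc Fin.zero)) Fin.zero = true
pawAdj (Fin.suc (Fin.suc Fin.zero)) (Fin.suc Fin.zero) = true
pawAdj (Fin.suc (Fin.suc (Fin.suc Fin.zero))) Fin.zero = true
pawAdj _ _ = false

record InducedPaw {n : ℕ} (G : SimpleGraph n) : Set where
  field
    f        : Fin 4 → Fin n
    injective : ∀ a b → f a ≡ f b → a ≡ b
    preserves : ∀ a b → adj G (f a) (f b) ≡ pawAdj a b

PawFree : ∀ {n} → SimpleGraph n → Set
PawFree G = ¬ InducedPaw G

-- A complete multipartite graph is paw-free: being in the same part is an equivalence
-- relation, but the pendant vertex of a paw is non-adjacent to two vertices that are
-- adjacent to each other. Adding isolated vertices preserves paw-freeness, as the paw
-- has no isolated vertex. Given m ≤ C(n,2), either m ≤ C(n-1,2) and an isolated vertex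
-- reduces to n - 1 vertices, or d = C(n,2) - m ≤ n - 2; writing d = 3t + r with r ≤ 2,
-- t parts of size 3, r parts of size 2 and singletons fit into n vertices and miss
-- exactly d = 3t + r of the C(n,2) possible edges.
module Submission where

open import Defs
open import Data.Nat using (ℕ; _≤_)
open import Data.Nat.Combinatorics using (_C_)
open import Data.Product using (Σ; _×_)
open import Relation.Binary.PropositionalEquality using (_≡_)

open import Data.Bool using (Bool; true; false; not; _∧_)
open import Data.Bool.Properties using (T?)
open import Data.Fin using (Fin; zero; suc; toℕ)
open import Data.List using (List; []; _∷_; [_]; _++_; length; filter; map; cartesianProduct; allFin)
open import Data.List.Properties using (filter-++; length-++; length-tabulate; map-++; map-∘; map-tabulate)
open import Data.Nat using (zero; suc; z≤n; s≤s; _∸_; _≤?_; _+_; _*_; _<_; _<ᵇ_; _≟_)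
open import Data.Nat.Properties using (+-commutativeSemigroup; +-assoc; +-comm; m≤n+m; m<n⇒m<1+n; <⇒≢; <-≤-trans; ≤-reflexive; ∸-monoʳ-<; m+n∸n≡m; m+[n∸m]≡n; +-cancelʳ-≡; ≰⇒>)
open import Data.Nat.Combinatorics using (nCk+nC[k+1]≡[n+1]C[k+1]; nC1≡n)
open import Data.Nat.Solver using (module +-*-Solver)
open import Data.Product using (_,_; proj₁; proj₂)
import Data.Product as Product
open import Function using (_∘_; id)
open import Relation.Nullary using (yes; no; does; contradiction)
open import Relation.Nullary.Decidable using (dec-true; dec-false)
open import Relation.Binary.PropositionalEquality using (_≢_; refl; trans; cong; cong₂; module ≡-Reasoning)
import Relation.Binary.PropositionalEquality as ≡
open import Algebra.Properties.CommutativeSemigroup +-commutativeSemigroup using (interchange)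

private
  variable
    A B X Y : Set
    n : ℕ

count : (A → Bool) → List A → ℕ
count p xs = length (filter (T? ∘ p) xs)

count-++ : ∀ (p : A → Bool) xs ys → count p (xs ++ ys) ≡ count p xs + count p ys
count-++ p xs ys = trans (cong length (filter-++ (T? ∘ p) xs ys)) (length-++ (filter (T? ∘ p) xs))

count-map : ∀ (p : B → Bool) (f : A → B) xs → count p (map f xs) ≡ count (p ∘ f) xs
count-map p f [] = refl
count-map p f (x ∷ xs) with p (f x)
... | true  = cong suc (count-map p f xs)
... | false = count-map p f xs

count-reject : ∀ (p : A → Bool) {x} xs → p x ≡ false → count p (x ∷ xs) ≡ count p xs
count-reject p {x} xs px with p x | px
... | false | refl = refl

count-all : ∀ (p : A → Bool) xs → (∀ x → p x ≡ true) → count p xs ≡ length xs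
count-all p [] _ = refl
count-all p (x ∷ xs) all with p x | all x
... | true | refl = cong suc (count-all p xs all)

count-const-false : ∀ (xs : List A) → count (λ _ → false) xs ≡ 0
count-const-false [] = refl
count-const-false (x ∷ xs) = count-const-false xs

count-cartesianProduct-∷ʳ : ∀ (p : A × B → Bool) xs y ys →
  count p (cartesianProduct xs (y ∷ ys)) ≡ count (λ x → p (x , y)) xs + count p (cartesianProduct xs ys)
count-cartesianProduct-∷ʳ p [] y ys = refl
count-cartesianProduct-∷ʳ p (x ∷ xs) y ys = begin
  count p ((x , y) ∷ map (x ,_) ys ++ cartesianProduct xs (y ∷ ys))
    ≡⟨ count-++ p ((x , y) ∷ map (x ,_) ys) _ ⟩
  count p ((x , y) ∷ map (x ,_) ys) + count p (cartesianProduct xs (y ∷ ys))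
    ≡⟨ cong₂ _+_ (count-++ p [ x , y ] (map (x ,_) ys)) (count-cartesianProduct-∷ʳ p xs y ys) ⟩
  (count p [ x , y ] + count p (map (x ,_) ys)) + (count (λ x → p (x , y)) xs + count p (cartesianProduct xs ys))
    ≡⟨ interchange (count p [ x , y ]) _ _ _ ⟩
  (count p [ x , y ] + count (λ x → p (x , y)) xs) + (count p (map (x ,_) ys) + count p (cartesianProduct xs ys))
    ≡⟨ cong (λ c → (c + count (λ x → p (x , y)) xs) + _) (count-map p (_, y) [ x ]) ⟩
  (count (λ x → p (x , y)) [ x ] + count (λ x → p (x , y)) xs) + (count p (map (x ,_) ys) + count p (cartesianProduct xs ys))
    ≡⟨ cong (_+ _) (count-++ (λ x → p (x , y)) [ x ] xs) ⟨
  count (λ x → p (x , y)) (x ∷ xs) + (count p (map (x ,_) ys) + count p (cartesianProduct xs ys))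
    ≡⟨ cong (count (λ x → p (x , y)) (x ∷ xs) +_) (count-++ p (map (x ,_) ys) _) ⟨
  count (λ x → p (x , y)) (x ∷ xs) + count p (cartesianProduct (x ∷ xs) ys) ∎
  where open ≡-Reasoning

cartesianProduct-map : ∀ (f : A → X) (g : B → Y) xs ys →
  cartesianProduct (map f xs) (map g ys) ≡ map (Product.map f g) (cartesianProduct xs ys)
cartesianProduct-map f g [] ys = refl
cartesianProduct-map f g (x ∷ xs) ys = begin
  map (f x ,_) (map g ys) ++ cartesianProduct (map f xs) (map g ys)
    ≡⟨ cong₂ _++_ (≡.sym (map-∘ ys)) (cartesianProduct-map f g xs ys) ⟩
  map (λ y → f x , g y) ys ++ map (Product.map f g) (cartesianProduct xs ys)
    ≡⟨ cong (_++ _) (map-∘ ys) ⟩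
  map (Product.map f g) (map (x ,_) ys) ++ map (Product.map f g) (cartesianProduct xs ys)
    ≡⟨ map-++ (Product.map f g) (map (x ,_) ys) _ ⟨
  map (Product.map f g) (cartesianProduct (x ∷ xs) ys) ∎
  where open ≡-Reasoning

allFin-suc : ∀ n → allFin (suc n) ≡ zero ∷ map suc (allFin n)
allFin-suc n = cong (zero ∷_) (≡.sym (map-tabulate id suc))

count-allFin-suc : ∀ (p : Fin (suc n) → Bool) → p zero ≡ false →
  count p (allFin (suc n)) ≡ count (p ∘ suc) (allFin n)
count-allFin-suc {n} p p0 = begin
  count p (allFin (suc n))            ≡⟨ cong (count p) (allFin-suc n) ⟩
  count p (zero ∷ map suc (allFin n)) ≡⟨ count-reject p _ p0 ⟩
  count p (map suc (allFin n))        ≡⟨ count-map p suc (allFin n) ⟩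
  count (p ∘ suc) (allFin n)          ∎
  where open ≡-Reasoning

deleteZero : SimpleGraph (suc n) → SimpleGraph n
deleteZero G = record
  { adj    = λ i j → adj G (suc i) (suc j)
  ; sym    = λ i j → sym G (suc i) (suc j)
  ; irrefl = irrefl G ∘ suc
  }

edgeCount-suc : (G : SimpleGraph (suc n)) →
  edgeCount G ≡ count (adj G zero ∘ suc) (allFin n) + edgeCount (deleteZero G)
edgeCount-suc {n} G = begin
  count isEdge (cartesianProduct (allFin (suc n)) (allFin (suc n)))
    ≡⟨ cong (λ xs → count isEdge (cartesianProduct xs xs)) (allFin-suc n) ⟩
  count isEdge (map (zero ,_) (zero ∷ L) ++ cartesianProduct L (zero ∷ L))
    ≡⟨ count-++ isEdge (map (zero ,_) (zero ∷ L)) _ ⟩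
  count isEdge (map (zero ,_) (zero ∷ L)) + count isEdge (cartesianProduct L (zero ∷ L))
    ≡⟨ cong₂ _+_ (count-map isEdge (zero ,_) (zero ∷ L)) (count-cartesianProduct-∷ʳ isEdge L zero L) ⟩
  count (isEdge ∘ (zero ,_)) L + (count (λ x → isEdge (x , zero)) L + count isEdge (cartesianProduct L L))
    ≡⟨ cong₂ _+_ (count-map (isEdge ∘ (zero ,_)) suc (allFin n))
                  (cong₂ _+_ (trans (count-map _ suc (allFin n)) (count-const-false (allFin n)))
                             (cong (count isEdge) (cartesianProduct-map suc suc (allFin n) (allFin n)))) ⟩
  count (adj G zero ∘ suc) (allFin n) + count isEdge (map (Product.map suc suc) (cartesianProduct (allFin n) (allFin n)))
    ≡⟨ cong (count (adj G zero ∘ suc) (allFin n) +_) (count-map isEdge (Product.map suc suc) (cartesianProduct (allFin n) (allFin n))) ⟩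
  count (adj G zero ∘ suc) (allFin n) + edgeCount (deleteZero G) ∎
  where
    open ≡-Reasoning
    L = map suc (allFin n)
    isEdge : Fin (suc n) × Fin (suc n) → Bool
    isEdge p = (toℕ (proj₁ p) <ᵇ toℕ (proj₂ p)) ∧ adj G (proj₁ p) (proj₂ p)

addIsolatedVertex : SimpleGraph n → SimpleGraph (suc n)
addIsolatedVertex {n} G = record { adj = adj′ ; sym = sym′ ; irrefl = irrefl′ }
  where
    adj′ : Fin (suc n) → Fin (suc n) → Bool
    adj′ (suc i) (suc j) = adj G i j
    adj′ _       _       = false

    sym′ : ∀ i j → adj′ i j ≡ adj′ j i
    sym′ zero    zero    = refl
    sym′ zero    (suc j) = refl
    sym′ (suc i) zero    = refl
    sym′ (suc i) (suc j) = sym G i j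

    irrefl′ : ∀ i → adj′ i i ≡ false
    irrefl′ zero    = refl
    irrefl′ (suc i) = irrefl G i

edgeCount-addIsolatedVertex : (G : SimpleGraph n) → edgeCount (addIsolatedVertex G) ≡ edgeCount G
edgeCount-addIsolatedVertex {n} G =
  trans (edgeCount-suc (addIsolatedVertex G)) (cong (_+ edgeCount G) (count-const-false (allFin n)))

pawAdj-neighbour : (a : Fin 4) → Σ (Fin 4) λ b → pawAdj a b ≡ true
pawAdj-neighbour zero = suc zero , refl
pawAdj-neighbour (suc zero) = zero , refl
pawAdj-neighbour (suc (suc zero)) = zero , refl
pawAdj-neighbour (suc (suc (suc zero))) = zero , refl

addIsolatedVertex-pawFree : (G : SimpleGraph n) → PawFree G → PawFree (addIsolatedVertex G)
addIsolatedVertex-pawFree {n} G pawFree paw = pawFree record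
  { f         = λ a → proj₁ (old a)
  ; injective = λ a b e → injective a b (trans (proj₂ (old a)) (trans (cong suc e) (≡.sym (proj₂ (old b)))))
  ; preserves = λ a b → trans (cong₂ (adj G′) (≡.sym (proj₂ (old a))) (≡.sym (proj₂ (old b)))) (preserves a b)
  }
  where
    open InducedPaw paw
    G′ = addIsolatedVertex G

    notIsolated : ∀ x y → adj G′ x y ≡ true → Σ (Fin n) λ i → x ≡ suc i
    notIsolated zero    y ()
    notIsolated (suc i) y _ = i , refl

    old : (a : Fin 4) → Σ (Fin n) λ i → f a ≡ suc i
    old a = let (b , ab) = pawAdj-neighbour a in notIsolated (f a) (f b) (trans (preserves a b) ab)

differ : ℕ → ℕ → Bool
differ a b = not (does (a ≟ b))

differ-≡ : ∀ {a b} → a ≡ b → differ a b ≡ false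
differ-≡ {a} {b} a≡b = cong not (dec-true (a ≟ b) a≡b)

differ-≢ : ∀ {a b} → a ≢ b → differ a b ≡ true
differ-≢ {a} {b} a≢b = cong not (dec-false (a ≟ b) a≢b)

differ-sym : ∀ a b → differ a b ≡ differ b a
differ-sym a b with a ≟ b
... | yes a≡b = trans (differ-≡ a≡b) (≡.sym (differ-≡ (≡.sym a≡b)))
... | no  a≢b = trans (differ-≢ a≢b) (≡.sym (differ-≢ (a≢b ∘ ≡.sym)))

differ-false⇒≡ : ∀ a b → differ a b ≡ false → a ≡ b
differ-false⇒≡ a b e with a ≟ b
... | yes a≡b = a≡b
... | no  a≢b = contradiction (trans (≡.sym (differ-≢ a≢b)) e) λ ()

completeMultipartite : (Fin n → ℕ) → SimpleGraph n
completeMultipartite part = record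
  { adj    = λ i j → differ (part i) (part j)
  ; sym    = λ i j → differ-sym (part i) (part j)
  ; irrefl = λ i → differ-≡ {part i} refl
  }

completeMultipartite-pawFree : (part : Fin n → ℕ) → PawFree (completeMultipartite part)
completeMultipartite-pawFree part paw =
  -- the pendant vertex v₃ shares its part with both ends of the edge v₁v₂
  contradiction (trans (≡.sym (preserves v₁ v₂)) (differ-≡ same₁₂)) λ ()
  where
    open InducedPaw paw
    v₁ v₂ v₃ : Fin 4
    v₁ = suc zero
    v₂ = suc (suc zero)
    v₃ = suc (suc (suc zero))
    label : Fin 4 → ℕ
    label = part ∘ f
    same₁₂ : label v₁ ≡ label v₂
    same₁₂ = trans (≡.sym (differ-false⇒≡ (label v₃) (label v₁) (preserves v₃ v₁)))
                   (differ-false⇒≡ (label v₃) (label v₂) (preserves v₃ v₂))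

prependPart : ∀ s {k} → ℕ → (Fin k → ℕ) → Fin (s + k) → ℕ
prependPart zero    l part i       = part i
prependPart (suc s) l part zero    = l
prependPart (suc s) l part (suc i) = prependPart s l part i

prependPart-< : ∀ s {k} {part : Fin k → ℕ} → (∀ i → part i < k) → ∀ i → prependPart s k part i < s + k
prependPart-< zero    bounded i       = bounded i
prependPart-< (suc s) {k} bounded zero    = s≤s (m≤n+m k s)
prependPart-< (suc s) bounded (suc i) = m<n⇒m<1+n (prependPart-< s bounded i)

count-differ-prependPart : ∀ s {k} l (part : Fin k → ℕ) →
  count (differ l ∘ prependPart s l part) (allFin (s + k)) ≡ count (differ l ∘ part) (allFin k)
count-differ-prependPart zero    l part = refl
count-differ-prependPart (suc s) l part =
  trans (count-allFin-suc (differ l ∘ prependPart (suc s) l part) (differ-≡ {l} refl))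
        (count-differ-prependPart s l part)

count-differ-fresh : ∀ {k} l (part : Fin k → ℕ) → (∀ i → part i ≢ l) → count (differ l ∘ part) (allFin k) ≡ k
count-differ-fresh {k} l part fresh =
  trans (count-all (differ l ∘ part) (allFin k) (λ i → differ-≢ (fresh i ∘ ≡.sym))) (length-tabulate id)

edgeCount-prependPart : ∀ s {k} l (part : Fin k → ℕ) → (∀ i → part i ≢ l) →
  edgeCount (completeMultipartite (prependPart s l part)) ≡ s * k + edgeCount (completeMultipartite part)
edgeCount-prependPart zero    l part fresh = refl
edgeCount-prependPart (suc s) {k} l part fresh = begin
  edgeCount (completeMultipartite (prependPart (suc s) l part))
    ≡⟨ edgeCount-suc (completeMultipartite (prependPart (suc s) l part)) ⟩
  count (differ l ∘ prependPart s l part) (allFin (s + k)) + edgeCount (completeMultipartite (prependPart s l part))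
    ≡⟨ cong₂ _+_ (trans (count-differ-prependPart s l part) (count-differ-fresh l part fresh))
                 (edgeCount-prependPart s l part fresh) ⟩
  k + (s * k + edgeCount (completeMultipartite part))
    ≡⟨ +-assoc k (s * k) _ ⟨
  suc s * k + edgeCount (completeMultipartite part) ∎
  where open ≡-Reasoning

suc-C2 : ∀ n → suc n C 2 ≡ n + n C 2
suc-C2 n = trans (≡.sym (nCk+nC[k+1]≡[n+1]C[k+1] n 1)) (cong (_+ n C 2) (nC1≡n n))

+-C2 : ∀ s k → (s + k) C 2 ≡ s C 2 + s * k + k C 2
+-C2 zero    k = refl
+-C2 (suc s) k = begin
  suc (s + k) C 2                       ≡⟨ suc-C2 (s + k) ⟩
  s + k + (s + k) C 2                   ≡⟨ cong (s + k +_) (+-C2 s k) ⟩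
  s + k + (s C 2 + s * k + k C 2)       ≡⟨ solve 5 (λ s k a b c → s :+ k :+ (a :+ c :+ b) := s :+ a :+ (k :+ c) :+ b) refl s k (s C 2) (k C 2) (s * k) ⟩
  s + s C 2 + (k + s * k) + k C 2       ≡⟨ cong (λ c → c + (k + s * k) + k C 2) (suc-C2 s) ⟨
  suc s C 2 + suc s * k + k C 2         ∎
  where
    open ≡-Reasoning
    open +-*-Solver

-- Parts are labelled by numbers below k, so that k is a fresh label for a new part.
MultipartiteMissing : ℕ → ℕ → Set
MultipartiteMissing k d =
  Σ (Fin k → ℕ) λ part → (∀ i → part i < k) × (edgeCount (completeMultipartite part) + d ≡ k C 2)

addPart : ∀ s {k d} → MultipartiteMissing k d → MultipartiteMissing (s + k) (s C 2 + d)
addPart s {k} {d} (part , bounded , missing) = prependPart s k part , prependPart-< s bounded , (begin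
  edgeCount (completeMultipartite (prependPart s k part)) + (s C 2 + d)
    ≡⟨ cong (_+ (s C 2 + d)) (edgeCount-prependPart s k part (<⇒≢ ∘ bounded)) ⟩
  (s * k + e) + (s C 2 + d)   ≡⟨ interchange (s * k) e (s C 2) d ⟩
  (s * k + s C 2) + (e + d)   ≡⟨ cong₂ _+_ (+-comm (s * k) (s C 2)) missing ⟩
  (s C 2 + s * k) + k C 2     ≡⟨ +-C2 s k ⟨
  (s + k) C 2                 ∎)
  where
    open ≡-Reasoning
    e = edgeCount (completeMultipartite part)

completeGraph : ∀ k → MultipartiteMissing k 0
completeGraph zero    = (λ ()) , (λ ()) , refl
completeGraph (suc k) = addPart 1 (completeGraph k)

multipartiteMissing : ∀ d {k} → 2 + d ≤ k → MultipartiteMissing k d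
multipartiteMissing 0 {k} _ = completeGraph k
multipartiteMissing 1 (s≤s (s≤s (s≤s {n = k} _))) = addPart 2 (completeGraph (suc k))
multipartiteMissing 2 (s≤s (s≤s (s≤s (s≤s {n = k} _)))) = addPart 2 (addPart 2 (completeGraph k))
multipartiteMissing (suc (suc (suc d))) (s≤s (s≤s (s≤s 2+d≤k))) = addPart 3 (multipartiteMissing d 2+d≤k)

fewMissing : ∀ n m → n C 2 < m → m ≤ suc n C 2 → 2 + (suc n C 2 ∸ m) ≤ suc n
fewMissing n m n₂<m m≤ = s≤s (<-≤-trans (∸-monoʳ-< n₂<m m≤) (≤-reflexive (begin
  suc n C 2 ∸ n C 2   ≡⟨ cong (_∸ n C 2) (suc-C2 n) ⟩
  n + n C 2 ∸ n C 2   ≡⟨ m+n∸n≡m n (n C 2) ⟩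
  n                   ∎)))
  where open ≡-Reasoning

pawFreeGraphWithEdges : ∀ n m → m ≤ n C 2 → Σ (SimpleGraph n) λ G → (edgeCount G ≡ m) × PawFree G
pawFreeGraphWithEdges zero .zero z≤n = completeMultipartite (λ ()) , refl , completeMultipartite-pawFree (λ ())
pawFreeGraphWithEdges (suc n) m m≤ with m ≤? n C 2
... | yes m≤n₂ with pawFreeGraphWithEdges n m m≤n₂
...   | G , edges , pawFree =
  addIsolatedVertex G , trans (edgeCount-addIsolatedVertex G) edges , addIsolatedVertex-pawFree G pawFree
pawFreeGraphWithEdges (suc n) m m≤ | no m≰n₂ with multipartiteMissing _ (fewMissing n m (≰⇒> m≰n₂) m≤)
...   | part , _ , missing =
  completeMultipartite part ,
  +-cancelʳ-≡ (suc n C 2 ∸ m) _ m (trans missing (≡.sym (m+[n∸m]≡n m≤))) ,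
  completeMultipartite-pawFree part

mainTheorem2 : (n m : ℕ) → 1 ≤ n → m ≤ n C 2 →
    Σ (SimpleGraph n) (λ G → (edgeCount G ≡ m) × PawFree G)
mainTheorem2 n m _ = pawFreeGraphWithEdges n m
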